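{- Let $\hat{\mathcal{P}}$ be a finite protocol instance, $\mathsf{s}$ one of its sorts, and $\varphi$ a quantifier-free clause in which all constants of $\mathsf{s}$ appear identically. Write $\varphi=\varphi_{others}\vee\bigvee_{c\in\mathsf{s}}\varphi_{\mathsf{s}}(c)$, where $\varphi_{others}$ is the disjunction of the literals of $\varphi$ containing no constant of $\mathsf{s}$ (possibly $\bot$) and $\varphi_{\mathsf{s}}(c)$ is the disjunction of the literals of $\varphi$ containing the constant $c$, and let $\widehat{\varphi_{\mathsf{s}}}$ be the clause in a variable $V$ of sort $\mathsf{s}$ obtained by replacing $c$ by $V$ in $\varphi_{\mathsf{s}}(c)$ (the same clause for every $c\in\mathsf{s}$). Let $\Phi(\mathsf{s})=\varphi_{others}\vee\exists V\in\mathsf{s}:\ \widehat{\varphi_{\mathsf{s}}}$. Then $\Phi(\mathsf{s})$ is logically equivalent to $\varphi^{L(Sym(\mathsf{s}))}=\bigwedge_{\gamma\in Sym(\mathsf{s})}\varphi^{\gamma}$.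
   Context: A finite protocol instance has finitely many sorts, each a finite set of distinct constants; state variables are Boolean variables $r(c_1,\dots,c_k)$ obtained by instantiating protocol relations with sort constants, and a clause is a disjunction of literals over them. $Sym(\mathsf{s})$ is the symmetric group on the constants of sort $\mathsf{s}$; for $\gamma\in Sym(\mathsf{s})$, $\varphi^{\gamma}$ is obtained by replacing each constant $c$ of $\mathsf{s}$ in $\varphi$ by $\gamma(c)$. Two constants $c_i,c_j$ of $\mathsf{s}$ appear identically in $\varphi$ if both occur in $\varphi$ and swapping them yields a logically equivalent clause, $\varphi^{(c_i\ c_j)}\equiv\varphi$; "all constants of $\mathsf{s}$ appear identically in $\varphi$" means every constant of $\mathsf{s}$ occurs in $\varphi$ and every pair of them appears identically. -}

module Defs where

open import Data.Nat using (ℕ)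
open import Data.Fin using (Fin; _≟_)
open import Data.Fin.Permutation using (Permutation′; _⟨$⟩ʳ_; transpose)
open import Data.Bool using (Bool; true; false; not; _∨_; if_then_else_; T)
open import Data.List using (List; []; _∷_; map)
open import Data.List.Relation.Unary.All using (All; []; _∷_)
open import Data.List.Membership.Propositional using (_∈_)
open import Data.Sum using (_⊎_; inj₁; inj₂)
open import Data.Product using (Σ; ∃; _×_)
open import Relation.Nullary using (yes; no; ¬_)
open import Relation.Nullary.Decidable using (⌊_⌋)
open import Relation.Binary.PropositionalEquality using (_≡_; _≢_; refl)
open import Function.Bundles using (_⇔_)

-- A finite protocol instance: finitely many sorts, sort σ has the
-- constants Fin (size σ); finitely many relations, relation r has the
-- argument sorts argSorts r.
record Instance : Set where
  field
    nSorts   : ℕ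
    size     : Fin nSorts → ℕ
    nRels    : ℕ
    argSorts : Fin nRels → List (Fin nSorts)

filterᵇ : {A : Set} → (A → Bool) → List A → List A
filterᵇ p [] = []
filterᵇ p (x ∷ xs) = if p x then x ∷ filterᵇ p xs else filterᵇ p xs

anyᵇ : {A : Set} → (A → Bool) → List A → Bool
anyᵇ p [] = false
anyᵇ p (x ∷ xs) = p x ∨ anyᵇ p xs

module Protocol (P : Instance) where
  open Instance P public

  Sort : Set
  Sort = Fin nSorts

  Const : Sort → Set
  Const σ = Fin (size σ)

  Args : Fin nRels → Set
  Args r = All Const (argSorts r)

  record Literal : Set where
    constructor lit
    field
      pos  : Bool
      rel  : Fin nRels
      args : Args rel

  Clause : Set
  Clause = List Literal

  State : Set
  State = (r : Fin nRels) → Args r → Bool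

  evalLit : State → Literal → Bool
  evalLit st (lit true r a) = st r a
  evalLit st (lit false r a) = not (st r a)

  evalClause : State → Clause → Bool
  evalClause st φ = anyᵇ (evalLit st) φ

module OnSort (P : Instance) (s : Fin (Instance.nSorts P)) where
  open Protocol P

  renArg : (Const s → Const s) → {σ : Sort} → Const σ → Const σ
  renArg f {σ} x with σ ≟ s
  ... | yes refl = f x
  ... | no _ = x

  renArgs : (Const s → Const s) → {σs : List Sort} → All Const σs → All Const σs
  renArgs f [] = []
  renArgs f (x ∷ xs) = renArg f x ∷ renArgs f xs

  renLit : (Const s → Const s) → Literal → Literal
  renLit f (lit b r a) = lit b r (renArgs f a)

  _^_ : Clause → Permutation′ (size s) → Clause
  φ ^ γ = map (renLit (γ ⟨$⟩ʳ_)) φ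

  _≈_ : Clause → Clause → Set
  φ ≈ ψ = ∀ (st : State) → evalClause st φ ≡ evalClause st ψ

  isS : Sort → Bool
  isS σ = ⌊ σ ≟ s ⌋

  hasSArgs : {σs : List Sort} → All Const σs → Bool
  hasSArgs [] = false
  hasSArgs (_∷_ {x = σ} _ xs) = isS σ ∨ hasSArgs xs

  hasSLit : Literal → Bool
  hasSLit (lit _ _ a) = hasSArgs a

  occArg : Const s → {σ : Sort} → Const σ → Bool
  occArg c {σ} x with σ ≟ s
  ... | yes refl = ⌊ x ≟ c ⌋
  ... | no _ = false

  occArgs : Const s → {σs : List Sort} → All Const σs → Bool
  occArgs c [] = false
  occArgs c (x ∷ xs) = occArg c x ∨ occArgs c xs

  occLit : Const s → Literal → Bool
  occLit c (lit _ _ a) = occArgs c a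

  OccursIn : Const s → Clause → Set
  OccursIn c φ = T (anyᵇ (occLit c) φ)

  AllAppearIdentically : Clause → Set
  AllAppearIdentically φ =
    (∀ (c : Const s) → OccursIn c φ) ×
    (∀ (c d : Const s) → c ≢ d → (φ ^ transpose c d) ≈ φ)

  φothers : Clause → Clause
  φothers φ = filterᵇ (λ l → not (hasSLit l)) φ

  φs : Clause → Const s → Clause
  φs φ c = filterᵇ (occLit c) φ

  -- Clauses in a variable V of sort s: an argument of sort σ is either a
  -- constant of σ, or V (only allowed when σ = s).
  OArg : Sort → Set
  OArg σ = Const σ ⊎ (σ ≡ s)

  record OLiteral : Set where
    constructor olit
    field
      pos  : Bool
      rel  : Fin nRels
      args : All OArg (argSorts rel)

  OClause : Set
  OClause = List OLiteral

  absArg : Const s → {σ : Sort} → Const σ → OArg σ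
  absArg c {σ} x with σ ≟ s
  ... | yes refl = if ⌊ x ≟ c ⌋ then inj₂ refl else inj₁ x
  ... | no _ = inj₁ x

  absArgs : Const s → {σs : List Sort} → All Const σs → All OArg σs
  absArgs c [] = []
  absArgs c (x ∷ xs) = absArg c x ∷ absArgs c xs

  absClause : Const s → Clause → OClause
  absClause c = map (λ { (lit b r a) → olit b r (absArgs c a) })

  hatOf : Clause → Const s → OClause
  hatOf φ c = absClause c (φs φ c)

  instArg : Const s → {σ : Sort} → OArg σ → Const σ
  instArg v (inj₁ x) = x
  instArg v (inj₂ refl) = v

  instArgs : Const s → {σs : List Sort} → All OArg σs → All Const σs
  instArgs v [] = []
  instArgs v (x ∷ xs) = instArg v x ∷ instArgs v xs

  instClause : Const s → OClause → Clause
  instClause v = map (λ { (olit b r a) → lit b r (instArgs v a) })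

  SameClause : OClause → OClause → Set
  SameClause ψ χ = ∀ (l : OLiteral) → (l ∈ ψ) ⇔ (l ∈ χ)

  ΦHolds : Clause → OClause → State → Set
  ΦHolds φ hat st =
    T (evalClause st (φothers φ)) ⊎ (∃ λ (v : Const s) → T (evalClause st (instClause v hat)))

  SymConjHolds : Clause → State → Set
  SymConjHolds φ st = ∀ (γ : Permutation′ (size s)) → T (evalClause st (φ ^ γ))

module Submission where

-- Renaming by γ ∈ Sym(s) fixes every literal without constants of s.  A literal of φ
-- mentioning c mentions no other constant of s, since hat is the abstraction of φ_s(d)
-- for every d; so γ sends it to the instance at γ(c) of a literal of hat.  Hence a true
-- literal of φ_others, or of hat at V := v, yields a true literal of φ^γ (take c = γ⁻¹ v).
-- Conversely φ = φ^id holds, and a true literal of φ lies in φ_others or, mentioning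
-- some c, is the instance at c of its abstraction, which lies in hat.

open import Defs
open import Data.Bool using (Bool; true; false; not; T; T?; _∨_)
open import Data.Bool.Properties using (T-∨; T-≡; T-not-≡)
open import Data.Empty using (⊥-elim)
open import Data.Fin using (Fin; _≟_)
open import Data.Fin.Permutation using (_⟨$⟩ʳ_; _⟨$⟩ˡ_; inverseʳ)
import Data.Fin.Permutation as Perm
open import Data.Bool.ListAction using (any)
open import Data.List using (List; []; _∷_)
import Data.List as List
open import Data.List.Relation.Unary.All using (All; []; _∷_)
open import Data.List.Relation.Unary.Any.Properties using (any⁺; any⁻)
open import Data.List.Membership.Propositional using (_∈_; find; lose)
open import Data.List.Membership.Propositional.Properties using (∈-map⁺; ∈-map⁻; ∈-filter⁺; ∈-filter⁻)
open import Data.Product using (∃; _×_; _,_)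
open import Data.Sum using (inj₁; inj₂; [_,_])
open import Function using (_∘_; id)
open import Function.Bundles using (_⇔_; mk⇔; Equivalence)
open import Relation.Nullary using (yes; no; ¬_)
open import Relation.Nullary.Decidable using (fromWitness; toWitness)
open import Relation.Binary.PropositionalEquality using (_≡_; _≢_; refl; sym; trans; cong; cong₂; subst)

private
  variable
    A : Set
    a b : Bool

T-∨⁺ˡ : T a → T (a ∨ b)
T-∨⁺ˡ = Equivalence.from T-∨ ∘ inj₁

T-∨⁺ʳ : T b → T (a ∨ b)
T-∨⁺ʳ = Equivalence.from T-∨ ∘ inj₂

anyᵇ≡any : (p : A → Bool) (xs : List A) → anyᵇ p xs ≡ any p xs
anyᵇ≡any p []       = refl
anyᵇ≡any p (x ∷ xs) = cong (p x ∨_) (anyᵇ≡any p xs)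

anyᵇ⁺ : (p : A → Bool) {xs : List A} {x : A} → x ∈ xs → T (p x) → T (anyᵇ p xs)
anyᵇ⁺ p {xs} x∈xs px rewrite anyᵇ≡any p xs = any⁺ p (lose x∈xs px)

anyᵇ⁻ : (p : A → Bool) (xs : List A) → T (anyᵇ p xs) → ∃ λ x → x ∈ xs × T (p x)
anyᵇ⁻ p xs h rewrite anyᵇ≡any p xs = find (any⁻ p xs h)

filterᵇ≡filterᵇ : (p : A → Bool) (xs : List A) → filterᵇ p xs ≡ List.filterᵇ p xs
filterᵇ≡filterᵇ p [] = refl
filterᵇ≡filterᵇ p (x ∷ xs) with p x
... | true  = cong (x ∷_) (filterᵇ≡filterᵇ p xs)
... | false = filterᵇ≡filterᵇ p xs

∈-filterᵇ⁺ : (p : A → Bool) {xs : List A} {x : A} → x ∈ xs → T (p x) → x ∈ filterᵇ p xs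
∈-filterᵇ⁺ p {xs} x∈xs px =
  subst (_ ∈_) (sym (filterᵇ≡filterᵇ p xs)) (∈-filter⁺ (T? ∘ p) x∈xs px)

∈-filterᵇ⁻ : (p : A → Bool) (xs : List A) {x : A} → x ∈ filterᵇ p xs → x ∈ xs × T (p x)
∈-filterᵇ⁻ p xs x∈ = ∈-filter⁻ (T? ∘ p) (subst (_ ∈_) (filterᵇ≡filterᵇ p xs) x∈)

module Symmetrisation (P : Instance) (s : Fin (Instance.nSorts P)) where
  open Protocol P
  open OnSort P s

  absLit : Const s → Literal → OLiteral
  absLit c (lit b r a) = olit b r (absArgs c a)

  instLit : Const s → OLiteral → Literal
  instLit v (olit b r a) = lit b r (instArgs v a)

  NoOtherConst : Const s → {σs : List Sort} → All Const σs → Set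
  NoOtherConst c a = ∀ d → c ≢ d → ¬ T (occArgs d a)

  renArgs-fresh : ∀ f {σs} (a : All Const σs) → T (not (hasSArgs a)) → renArgs f a ≡ a
  renArgs-fresh f []                  _ = refl
  renArgs-fresh f (_∷_ {x = σ} x xs) h with σ ≟ s
  ... | yes refl = ⊥-elim h
  ... | no _     = cong (x ∷_) (renArgs-fresh f xs h)

  renArgs-id : ∀ {σs} (a : All Const σs) → renArgs id a ≡ a
  renArgs-id []                  = refl
  renArgs-id (_∷_ {x = σ} x xs) with σ ≟ s
  ... | yes refl = cong (x ∷_) (renArgs-id xs)
  ... | no _     = cong (x ∷_) (renArgs-id xs)

  renArgs-absArgs : ∀ f c {σs} (a : All Const σs) → NoOtherConst c a →
    renArgs f a ≡ instArgs (f c) (absArgs c a)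
  renArgs-absArgs f c []                  _ = refl
  renArgs-absArgs f c (_∷_ {x = σ} x xs) h =
    cong₂ _∷_ (head σ x (λ d c≢d → h d c≢d ∘ T-∨⁺ˡ))
              (renArgs-absArgs f c xs (λ d c≢d → h d c≢d ∘ T-∨⁺ʳ))
    where
    head : ∀ σ (x : Const σ) → (∀ d → c ≢ d → ¬ T (occArg d x)) →
      renArg f x ≡ instArg (f c) (absArg c x)
    head σ x h with σ ≟ s
    ... | no _ = refl
    ... | yes refl with x ≟ c
    ...   | yes refl = refl
    ...   | no x≢c   = ⊥-elim (h x (x≢c ∘ sym) (fromWitness refl))

  instArgs-absArgs : ∀ c {σs} (a : All Const σs) → instArgs c (absArgs c a) ≡ a
  instArgs-absArgs c []                  = refl
  instArgs-absArgs c (_∷_ {x = σ} x xs) with σ ≟ s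
  ... | no _ = cong (x ∷_) (instArgs-absArgs c xs)
  ... | yes refl with x ≟ c
  ...   | yes refl = cong (x ∷_) (instArgs-absArgs c xs)
  ...   | no _     = cong (x ∷_) (instArgs-absArgs c xs)

  hasSArgs⇒occArgs : ∀ {σs} (a : All Const σs) → T (hasSArgs a) → ∃ λ c → T (occArgs c a)
  hasSArgs⇒occArgs (_∷_ {x = σ} x xs) h with σ ≟ s
  ... | yes refl = x , T-∨⁺ˡ (fromWitness {a? = x ≟ x} refl)
  ... | no _     = let c , o = hasSArgs⇒occArgs xs h in c , T-∨⁺ʳ o

  occArgs-instArgs-absArgs : ∀ {c d} → c ≢ d → ∀ {σs} (a : All Const σs) →
    ¬ T (occArgs d (instArgs c (absArgs d a)))
  occArgs-instArgs-absArgs {c} {d} c≢d (x ∷ xs) =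
    [ head _ x , occArgs-instArgs-absArgs c≢d xs ] ∘ Equivalence.to T-∨
    where
    head : ∀ σ (x : Const σ) → ¬ T (occArg d (instArg c (absArg d x)))
    head σ x o with σ ≟ s
    ... | no _ = o
    ... | yes refl with x ≟ d
    ...   | yes refl = c≢d (toWitness o)
    ...   | no x≢d   = x≢d (toWitness o)

  renLit-fresh : ∀ f l → T (not (hasSLit l)) → renLit f l ≡ l
  renLit-fresh f (lit b r a) h = cong (lit b r) (renArgs-fresh f a h)

  renLit-id : ∀ l → renLit id l ≡ l
  renLit-id (lit b r a) = cong (lit b r) (renArgs-id a)

  renLit-absLit : ∀ f c l → NoOtherConst c (Literal.args l) → renLit f l ≡ instLit (f c) (absLit c l)
  renLit-absLit f c (lit b r a) h = cong (lit b r) (renArgs-absArgs f c a h)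

  instLit-absLit : ∀ c l → instLit c (absLit c l) ≡ l
  instLit-absLit c (lit b r a) = cong (lit b r) (instArgs-absArgs c a)

  occLit-instLit-absLit : ∀ {c d} → c ≢ d → ∀ l → ¬ T (occLit d (instLit c (absLit d l)))
  occLit-instLit-absLit c≢d (lit b r a) = occArgs-instArgs-absArgs c≢d a

  module _ (φ : Clause) (hat : OClause) (hat≈ : ∀ c → SameClause hat (hatOf φ c)) where

    absLit∈hat : ∀ {c l} → l ∈ φ → T (occLit c l) → absLit c l ∈ hat
    absLit∈hat {c} l∈φ o =
      Equivalence.from (hat≈ c _) (∈-map⁺ (absLit c) (∈-filterᵇ⁺ (occLit c) l∈φ o))

    ∈hat⇒absLit : ∀ c {l′} → l′ ∈ hat → ∃ λ l → (l ∈ φ × T (occLit c l)) × l′ ≡ absLit c l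
    ∈hat⇒absLit c l′∈hat with ∈-map⁻ (absLit c) (Equivalence.to (hat≈ c _) l′∈hat)
    ... | l , l∈φₛ , refl = l , ∈-filterᵇ⁻ (occLit c) φ l∈φₛ , refl

    -- If l also mentioned d ≢ c, then absLit c l ∈ hat would be absLit d of some l″, which
    -- mentions no d; instantiating back at c shows l itself mentions no d.
    occLit⇒NoOtherConst : ∀ {c l} → l ∈ φ → T (occLit c l) → NoOtherConst c (Literal.args l)
    occLit⇒NoOtherConst {c} {l} l∈φ o d c≢d od with ∈hat⇒absLit d (absLit∈hat l∈φ o)
    ... | l″ , _ , absₗ≡absₗ″ = occLit-instLit-absLit c≢d l″ (subst (T ∘ occLit d) l≡ od)
      where
      l≡ : l ≡ instLit c (absLit d l″)
      l≡ = trans (sym (instLit-absLit c l)) (cong (instLit c) absₗ≡absₗ″)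

    Φ⇒symConj : ∀ st → ΦHolds φ hat st → SymConjHolds φ st
    Φ⇒symConj st (inj₁ others) γ with anyᵇ⁻ (evalLit st) (φothers φ) others
    ... | l , l∈others , u with ∈-filterᵇ⁻ (not ∘ hasSLit) φ l∈others
    ... | l∈φ , fresh = anyᵇ⁺ (evalLit st) (∈-map⁺ (renLit (γ ⟨$⟩ʳ_)) l∈φ)
                          (subst (T ∘ evalLit st) (sym (renLit-fresh (γ ⟨$⟩ʳ_) l fresh)) u)
    Φ⇒symConj st (inj₂ (v , hatᵥ)) γ with anyᵇ⁻ (evalLit st) _ hatᵥ
    ... | _ , m , u with ∈-map⁻ (instLit v) m
    ... | _ , l′∈hat , refl with ∈hat⇒absLit (γ ⟨$⟩ˡ v) l′∈hat
    ... | l , (l∈φ , o) , refl =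
      anyᵇ⁺ (evalLit st) (∈-map⁺ _ l∈φ) (subst (T ∘ evalLit st) (sym renₗ≡) u)
      where
      renₗ≡ : renLit (γ ⟨$⟩ʳ_) l ≡ instLit v (absLit (γ ⟨$⟩ˡ v) l)
      renₗ≡ = trans (renLit-absLit _ _ l (occLit⇒NoOtherConst l∈φ o))
                    (cong (λ w → instLit w (absLit (γ ⟨$⟩ˡ v) l)) (inverseʳ γ))

    litHolds⇒Φ : ∀ st {l} → l ∈ φ → T (evalLit st l) → ΦHolds φ hat st
    litHolds⇒Φ st {l} l∈φ u with hasSLit l in eq
    ... | false = inj₁ (anyᵇ⁺ (evalLit st) (∈-filterᵇ⁺ _ l∈φ (Equivalence.from T-not-≡ eq)) u)
    ... | true with hasSArgs⇒occArgs (Literal.args l) (Equivalence.from T-≡ eq)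
    ...   | c , o = inj₂ (c , anyᵇ⁺ (evalLit st) (∈-map⁺ (instLit c) (absLit∈hat l∈φ o))
                              (subst (T ∘ evalLit st) (sym (instLit-absLit c l)) u))

    symConj⇒Φ : ∀ st → SymConjHolds φ st → ΦHolds φ hat st
    symConj⇒Φ st holds with anyᵇ⁻ (evalLit st) _ (holds Perm.id)
    ... | _ , m , u with ∈-map⁻ (renLit (Perm.id ⟨$⟩ʳ_)) m
    ... | l , l∈φ , refl = litHolds⇒Φ st l∈φ (subst (T ∘ evalLit st) (renLit-id l) u)

theorem3 : (P : Instance) (s : Fin (Instance.nSorts P)) (φ : Protocol.Clause P)
    (hat : OnSort.OClause P s) →
    OnSort.AllAppearIdentically P s φ →
    (∀ (c : Protocol.Const P s) → OnSort.SameClause P s hat (OnSort.hatOf P s φ c)) →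
    ∀ (st : Protocol.State P) → OnSort.ΦHolds P s φ hat st ⇔ OnSort.SymConjHolds P s φ st
theorem3 P s φ hat _ hat≈ st = mk⇔ (Φ⇒symConj φ hat hat≈ st) (symConj⇒Φ φ hat hat≈ st)
  where open Symmetrisation P s
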